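{- Let $q\ge 1$ and let $G$ be a $(q+1,q)$-graph that admits a $1$-super graceful labeling in which all vertices receive odd labels; let $v$ be the vertex labeled $1$ in such a labeling. Let $n\ge 2$, let $P_n=u_1u_2\cdots u_n$ be a path, and let $G^v_n$ be the graph obtained from $G$ and $P_n$ by identifying $v$ with $u_1$. Then $G^v_n$ admits a $1$-super graceful labeling in which all vertices receive odd labels and $u_n$ receives the label $1$.
   Context: All graphs are simple, finite, undirected and without isolated vertices; a $(p,q)$-graph has $p$ vertices and $q$ edges. For integers $a\le b$, $[a,b]$ is the set of integers between $a$ and $b$ inclusive. For $k\ge 1$, a $k$-super graceful labeling of a $(p,q)$-graph $G=(V,E)$ is a bijection $f:V\cup E\to[k,k+p+q-1]$ with $f(uv)=|f(u)-f(v)|$ for every edge $uv$. -}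

module Defs where

open import Data.Nat using (ℕ; zero; suc; _+_; _*_; _∸_; _≤_; _<_; z≤n; s≤s; ∣_-_∣)
open import Data.Fin using (Fin; zero; suc; _↑ˡ_; _↑ʳ_; splitAt; inject₁; fromℕ)
open import Data.Product using (Σ; ∃; _×_; _,_; proj₁; proj₂)
open import Data.Sum using (_⊎_; inj₁; inj₂)
open import Relation.Binary.PropositionalEquality using (_≡_; _≢_)
open import Function.Definitions using (Injective)

record RawGraph (p q : ℕ) : Set where
  field
    ends : Fin q → Fin p × Fin p

open RawGraph public

src : ∀ {p q} → RawGraph p q → Fin q → Fin p
src G e = proj₁ (ends G e)

tgt : ∀ {p q} → RawGraph p q → Fin q → Fin p
tgt G e = proj₂ (ends G e)

SamePair : ∀ {p} → Fin p × Fin p → Fin p × Fin p → Set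
SamePair (a , b) (c , d) = (a ≡ c × b ≡ d) ⊎ (a ≡ d × b ≡ c)

record IsGraph {p q : ℕ} (G : RawGraph p q) : Set where
  field
    loopless   : ∀ e → src G e ≢ tgt G e
    noMultiple : ∀ e e′ → SamePair (ends G e) (ends G e′) → e ≡ e′
    noIsolated : ∀ v → ∃ λ e → (v ≡ src G e) ⊎ (v ≡ tgt G e)

Elem : ℕ → ℕ → Set
Elem p q = Fin p ⊎ Fin q

record SuperGraceful (k : ℕ) {p q : ℕ} (G : RawGraph p q) : Set where
  field
    f         : Elem p q → ℕ
    edgeLabel : ∀ e → f (inj₂ e) ≡ ∣ f (inj₁ (src G e)) - f (inj₁ (tgt G e)) ∣
    inRange   : ∀ x → k ≤ f x × f x ≤ k + p + q ∸ 1
    injective : Injective _≡_ _≡_ f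
    surjective : ∀ m → k ≤ m → m ≤ k + p + q ∸ 1 → ∃ λ x → f x ≡ m

Odd : ℕ → Set
Odd n = ∃ λ j → n ≡ suc (2 * j)

AllVerticesOdd : ∀ {k p q} {G : RawGraph p q} → SuperGraceful k G → Set
AllVerticesOdd {p = p} L = ∀ (v : Fin p) → Odd (SuperGraceful.f L (inj₁ v))

-- Previous vertex on the path: u_1 = v (old vertex), u_{j+2} = raise p j.
private
  pathPrev : ∀ {p m} → Fin p → Fin m → Fin (p + m)
  pathPrev {p} {m} v zero = v ↑ˡ m
  pathPrev {p} {suc m} v (suc j) = p ↑ʳ inject₁ j

-- G^v_n glued with a path of m = n - 1 new vertices u_2..u_n
-- (u_{j+2} is vertex p ↑ʳ j); new edges u_{j+1}u_{j+2} for j < m.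
glueRaw : ∀ {p q} → RawGraph p q → Fin p → (m : ℕ) → RawGraph (p + m) (q + m)
ends (glueRaw {p} {q} G v m) e with splitAt q e
... | inj₁ e′ = src G e′ ↑ˡ m , tgt G e′ ↑ˡ m
... | inj₂ j = pathPrev v j , p ↑ʳ j

Gvn : ∀ {p q} → RawGraph p q → Fin p → (n : ℕ) → RawGraph (p + (n ∸ 1)) (q + (n ∸ 1))
Gvn G v n = glueRaw G v (n ∸ 1)

lastPathVertex : ∀ {p} (n : ℕ) → 2 ≤ n → Fin (p + (n ∸ 1))
lastPathVertex {p} (suc (suc m)) (s≤s (s≤s z≤n)) = p ↑ʳ fromℕ m

module Submission where

-- A 1-super graceful labeling of a (T+1,T)-graph whose vertex
-- labels are all odd is the same thing as a graceful labeling scaled by two: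
-- vertex x carries 2·ℓ(x)+1 and edge uv carries 2·|ℓ(u)-ℓ(v)|, where ℓ maps
-- the vertices bijectively onto [0,T] and the induced edge labels cover
-- [1,T] bijectively.  So it suffices to extend a graceful labeling of G with
-- ℓ(v) = 0 to G^v_n with ℓ(u_n) = 0.
--
-- This is done one path vertex at a time: before attaching the (m+1)-st new
-- vertex the labels fill [0,q+m] and the newest vertex u carries 0.  Reflect
-- every label x ↦ (q+m+1) ∸ x; this keeps all edge labels, sends the labels
-- onto [1,q+m+1] and gives u the label q+m+1.  The new vertex gets 0 and its
-- edge to u the fresh label q+m+1.

open import Data.Nat using (ℕ; zero; suc; _+_; _*_; _∸_; _≤_; _<_; _≤′_; ≤′-refl; ≤′-step; z≤n; s≤s; s≤s⁻¹; ∣_-_∣; _≟_; _≤?_)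
open import Data.Nat.Properties
open import Data.Fin using (Fin; zero; suc; toℕ; _↑ˡ_; _↑ʳ_; splitAt; join; fromℕ<; inject₁; fromℕ)
open import Data.Fin.Properties using (splitAt-↑ˡ; splitAt-↑ʳ; splitAt-join; join-splitAt; toℕ-injective; toℕ-fromℕ<; toℕ-inject₁; toℕ<n; toℕ-fromℕ)
open import Data.Product using (∃; _×_; _,_; proj₁; proj₂)
open import Data.Sum using (_⊎_; inj₁; inj₂)
open import Data.Sum.Properties using (inj₁-injective; inj₂-injective)
open import Data.Empty using (⊥-elim)
open import Relation.Nullary using (yes; no)
open import Relation.Binary.PropositionalEquality
open import Function.Definitions using (Injective)
open import Defs

reflect-injective : ∀ {r x y} → x ≤ r → y ≤ r → r ∸ x ≡ r ∸ y → x ≡ y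
reflect-injective {r} x≤r y≤r eq =
  trans (sym (m∸[m∸n]≡n x≤r)) (trans (cong (r ∸_) eq) (m∸[m∸n]≡n y≤r))

reflect-distance : ∀ r x y → x ≤ r → y ≤ r → ∣ r ∸ x - r ∸ y ∣ ≡ ∣ x - y ∣
reflect-distance r zero y _ y≤r = trans (m≤n⇒∣n-m∣≡n∸m (m∸n≤m r y)) (m∸[m∸n]≡n y≤r)
reflect-distance r (suc x) zero x≤r _ = trans (m≤n⇒∣m-n∣≡n∸m (m∸n≤m r (suc x))) (m∸[m∸n]≡n x≤r)
reflect-distance (suc r) (suc x) (suc y) (s≤s x≤r) (s≤s y≤r) = reflect-distance r x y x≤r y≤r

even-or-odd : ∀ n → (∃ λ h → n ≡ 2 * h) ⊎ Odd n
even-or-odd zero = inj₁ (0 , refl)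
even-or-odd (suc n) with even-or-odd n
... | inj₁ (h , refl) = inj₂ (h , refl)
... | inj₂ (h , refl) = inj₁ (suc h , sym (*-suc 2 h))

odd-bound : ∀ {a T} → suc (2 * a) ≤ suc (2 * T) → a ≤ T
odd-bound le = *-cancelˡ-≤ 2 (s≤s⁻¹ le)

even-bound : ∀ {b T} → 2 * b ≤ suc (2 * T) → b ≤ T
even-bound {b} {T} le = *-cancelˡ-≤ 2 (s≤s⁻¹ (≤∧≢⇒< le (even≢odd b T)))

even-positive : ∀ b → 1 ≤ 2 * b → 1 ≤ b
even-positive (suc b) _ = s≤s z≤n

top-label : ∀ T → 1 + suc T + T ∸ 1 ≡ suc (2 * T)
top-label T = cong (λ z → suc (T + z)) (sym (+-identityʳ T))

splitAt-injective : ∀ a {b} {w w′ : Fin (a + b)} → splitAt a w ≡ splitAt a w′ → w ≡ w′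
splitAt-injective a {b} {w} {w′} eq =
  trans (sym (join-splitAt a b w)) (trans (cong (join a b) eq) (join-splitAt a b w′))

induced : ∀ {p q} → RawGraph p q → (Fin p → ℕ) → Fin q → ℕ
induced G ℓ e = ∣ ℓ (src G e) - ℓ (tgt G e) ∣

record Graceful {T : ℕ} (G : RawGraph (suc T) T) : Set where
  field
    label            : Fin (suc T) → ℕ
    label-bound      : ∀ x → label x ≤ T
    label-injective  : Injective _≡_ _≡_ label
    label-surjective : ∀ a → a ≤ T → ∃ λ x → label x ≡ a
    edge-positive    : ∀ e → 1 ≤ induced G label e
    edge-injective   : Injective _≡_ _≡_ (induced G label)
    edge-surjective  : ∀ b → 1 ≤ b → b ≤ T → ∃ λ e → induced G label e ≡ b

  edge-bound : ∀ e → induced G label e ≤ T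
  edge-bound e = ≤-trans (∣m-n∣≤m⊔n (label (src G e)) (label (tgt G e))) (⊔-lub (label-bound (src G e)) (label-bound (tgt G e)))

module Decode {T : ℕ} {G : RawGraph (suc T) T} (L : SuperGraceful 1 G) (odd : AllVerticesOdd L) where
  open SuperGraceful L

  half : Fin (suc T) → ℕ
  half x = proj₁ (odd x)

  vertex-label : ∀ x → f (inj₁ x) ≡ suc (2 * half x)
  vertex-label x = proj₂ (odd x)

  edge-label : ∀ e → f (inj₂ e) ≡ 2 * induced G half e
  edge-label e = trans (edgeLabel e)
    (trans (cong₂ ∣_-_∣ (vertex-label (src G e)) (vertex-label (tgt G e)))
           (sym (*-distribˡ-∣-∣ 2 (half (src G e)) (half (tgt G e)))))

  below-top : ∀ x → f x ≤ suc (2 * T)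
  below-top x = subst (f x ≤_) (top-label T) (proj₂ (inRange x))

  within-top : ∀ {n} → n ≤ suc (2 * T) → n ≤ 1 + suc T + T ∸ 1
  within-top {n} = subst (n ≤_) (sym (top-label T))

  half-surjective : ∀ a → a ≤ T → ∃ λ x → half x ≡ a
  half-surjective a a≤T with surjective (suc (2 * a)) (s≤s z≤n) (within-top (s≤s (*-monoʳ-≤ 2 a≤T)))
  ... | inj₁ x , fx = x , *-cancelˡ-≡ _ _ 2 (suc-injective (trans (sym (vertex-label x)) fx))
  ... | inj₂ e , fe = ⊥-elim (even≢odd (induced G half e) a (trans (sym (edge-label e)) fe))

  edge-surjective : ∀ b → 1 ≤ b → b ≤ T → ∃ λ e → induced G half e ≡ b
  edge-surjective (suc b) _ b≤T with surjective (2 * suc b) (subst (1 ≤_) (sym (*-suc 2 b)) (s≤s z≤n))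
                                       (within-top (m≤n⇒m≤1+n (*-monoʳ-≤ 2 b≤T)))
  ... | inj₁ x , fx = ⊥-elim (even≢odd (suc b) (half x) (trans (sym fx) (vertex-label x)))
  ... | inj₂ e , fe = e , *-cancelˡ-≡ _ _ 2 (trans (sym (edge-label e)) fe)

  graceful : Graceful G
  graceful = record
    { label            = half
    ; label-bound      = λ x → odd-bound (subst (_≤ suc (2 * T)) (vertex-label x) (below-top (inj₁ x)))
    ; label-injective  = λ eq → inj₁-injective (injective
        (trans (vertex-label _) (trans (cong (λ h → suc (2 * h)) eq) (sym (vertex-label _)))))
    ; label-surjective = half-surjective
    ; edge-positive    = λ e → even-positive (induced G half e) (subst (1 ≤_) (edge-label e) (proj₁ (inRange (inj₂ e))))
    ; edge-injective   = λ eq → inj₂-injective (injective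
        (trans (edge-label _) (trans (cong (2 *_) eq) (sym (edge-label _)))))
    ; edge-surjective  = edge-surjective
    }

module Encode {T : ℕ} {G : RawGraph (suc T) T} (g : Graceful G) where
  open Graceful g

  f : Elem (suc T) T → ℕ
  f (inj₁ x) = suc (2 * label x)
  f (inj₂ e) = 2 * induced G label e

  in-range : ∀ x → 1 ≤ f x × f x ≤ 1 + suc T + T ∸ 1
  in-range x = proj₁ (bounds x) , subst (f x ≤_) (sym (top-label T)) (proj₂ (bounds x))
    where
      bounds : ∀ x → 1 ≤ f x × f x ≤ suc (2 * T)
      bounds (inj₁ x) = s≤s z≤n , s≤s (*-monoʳ-≤ 2 (label-bound x))
      bounds (inj₂ e) = ≤-trans (s≤s z≤n) (*-monoʳ-≤ 2 (edge-positive e))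
                      , m≤n⇒m≤1+n (*-monoʳ-≤ 2 (edge-bound e))

  f-injective : Injective _≡_ _≡_ f
  f-injective {inj₁ x} {inj₁ y} eq = cong inj₁ (label-injective (*-cancelˡ-≡ _ _ 2 (suc-injective eq)))
  f-injective {inj₁ x} {inj₂ e} eq = ⊥-elim (even≢odd (induced G label e) (label x) (sym eq))
  f-injective {inj₂ e} {inj₁ x} eq = ⊥-elim (even≢odd (induced G label e) (label x) eq)
  f-injective {inj₂ e} {inj₂ e′} eq = cong inj₂ (edge-injective (*-cancelˡ-≡ _ _ 2 eq))

  f-surjective : ∀ n → 1 ≤ n → n ≤ 1 + suc T + T ∸ 1 → ∃ λ x → f x ≡ n
  f-surjective n 1≤n n≤top with even-or-odd n | subst (n ≤_) (top-label T) n≤top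
  ... | inj₁ (b , refl) | le with edge-surjective b (even-positive b 1≤n) (even-bound le)
  ...   | e , eb = inj₂ e , cong (2 *_) eb
  f-surjective n 1≤n n≤top | inj₂ (a , refl) | le with label-surjective a (odd-bound le)
  ...   | x , xa = inj₁ x , cong (λ h → suc (2 * h)) xa

  superGraceful : SuperGraceful 1 G
  superGraceful = record
    { f = f ; edgeLabel = λ e → *-distribˡ-∣-∣ 2 (label (src G e)) (label (tgt G e)) ; inRange = in-range
    ; injective = f-injective ; surjective = f-surjective }

  all-odd : AllVerticesOdd superGraceful
  all-odd x = label x , refl

-- A slot is an old vertex
-- (inj₁ a, originally labelled a ≤ q) or the j-th path vertex (inj₂ j);
-- after m steps the slots present are the old ones and inj₂ j for j < m.
module Growth (q : ℕ) where
  Slot : Set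
  Slot = ℕ ⊎ ℕ

  Present : ℕ → Slot → Set
  Present m (inj₁ a) = a ≤ q
  Present m (inj₂ j) = j < m

  stageLabel : ℕ → Slot → ℕ
  stageLabel zero (inj₁ a) = a
  stageLabel zero (inj₂ j) = 0
  stageLabel (suc m) (inj₁ a) = q + suc m ∸ stageLabel m (inj₁ a)
  stageLabel (suc m) (inj₂ j) with j ≟ m
  ... | yes _ = 0
  ... | no _ = q + suc m ∸ stageLabel m (inj₂ j)

  newborn-label : ∀ m → stageLabel (suc m) (inj₂ m) ≡ 0
  newborn-label m with m ≟ m
  ... | yes _ = refl
  ... | no m≢m = ⊥-elim (m≢m refl)

  reflected-label : ∀ m s → Present m s → stageLabel (suc m) s ≡ q + suc m ∸ stageLabel m s
  reflected-label m (inj₁ a) _ = refl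
  reflected-label m (inj₂ j) j<m with j ≟ m
  ... | yes refl = ⊥-elim (<-irrefl refl j<m)
  ... | no _ = refl

  present-step : ∀ m s → Present m s → Present (suc m) s
  present-step m (inj₁ a) a≤q = a≤q
  present-step m (inj₂ j) j<m = m<n⇒m<1+n j<m

  present-weaken : ∀ {k m} s → k ≤′ m → Present k s → Present m s
  present-weaken s ≤′-refl p = p
  present-weaken s (≤′-step k≤m) p = present-step _ s (present-weaken s k≤m p)

  present-suc : ∀ m s → Present (suc m) s → s ≡ inj₂ m ⊎ Present m s
  present-suc m (inj₁ a) a≤q = inj₂ a≤q
  present-suc m (inj₂ j) (s≤s j≤m) with j ≟ m
  ... | yes refl = inj₁ refl
  ... | no j≢m = inj₂ (≤∧≢⇒< j≤m j≢m)

  stage-bound : ∀ m s → Present m s → stageLabel m s ≤ q + m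
  stage-bound zero (inj₁ a) a≤q = subst (a ≤_) (sym (+-identityʳ q)) a≤q
  stage-bound (suc m) s p with present-suc m s p
  ... | inj₁ refl = subst (_≤ q + suc m) (sym (newborn-label m)) z≤n
  ... | inj₂ p′ = subst (_≤ q + suc m) (sym (reflected-label m s p′)) (m∸n≤m (q + suc m) (stageLabel m s))

  below-reflector : ∀ m s → Present m s → stageLabel m s < q + suc m
  below-reflector m s p = subst (stageLabel m s <_) (sym (+-suc q m)) (s≤s (stage-bound m s p))

  -- Reflected labels are positive, so they never clash with the newborn's 0.
  reflected-positive : ∀ m s → Present m s → 0 < stageLabel (suc m) s
  reflected-positive m s p =
    subst (0 <_) (sym (reflected-label m s p)) (m<n⇒0<n∸m (below-reflector m s p))

  stage-injective : ∀ m s t → Present m s → Present m t → stageLabel m s ≡ stageLabel m t → s ≡ t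
  stage-injective zero (inj₁ a) (inj₁ b) _ _ eq = cong inj₁ eq
  stage-injective (suc m) s t ps pt eq with present-suc m s ps | present-suc m t pt
  ... | inj₁ refl | inj₁ refl = refl
  ... | inj₁ refl | inj₂ pt′ =
    ⊥-elim (<-irrefl (trans (sym (newborn-label m)) eq) (reflected-positive m t pt′))
  ... | inj₂ ps′ | inj₁ refl =
    ⊥-elim (<-irrefl (trans (sym (newborn-label m)) (sym eq)) (reflected-positive m s ps′))
  ... | inj₂ ps′ | inj₂ pt′ = stage-injective m s t ps′ pt′
    (reflect-injective (<⇒≤ (below-reflector m s ps′)) (<⇒≤ (below-reflector m t pt′))
      (trans (sym (reflected-label m s ps′)) (trans eq (reflected-label m t pt′))))

  stage-surjective : ∀ m y → y ≤ q + m → ∃ λ s → Present m s × stageLabel m s ≡ y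
  stage-surjective zero y y≤q = inj₁ y , subst (y ≤_) (+-identityʳ q) y≤q , refl
  stage-surjective (suc m) zero _ = inj₂ m , n<1+n m , newborn-label m
  stage-surjective (suc m) (suc y) y<r with stage-surjective m (q + suc m ∸ suc y) reflected-in-range
    where
      reflected-in-range : q + suc m ∸ suc y ≤ q + m
      reflected-in-range = subst (λ r → r ∸ suc y ≤ q + m) (sym (+-suc q m)) (m∸n≤m (q + m) y)
  ... | s , p , eq = s , present-step m s p
                   , trans (reflected-label m s p) (trans (cong (q + suc m ∸_) eq) (m∸[m∸n]≡n y<r))

  gap : ℕ → Slot → Slot → ℕ
  gap m s t = ∣ stageLabel m s - stageLabel m t ∣

  gap-step : ∀ m s t → Present m s → Present m t → gap (suc m) s t ≡ gap m s t
  gap-step m s t ps pt =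
    trans (cong₂ ∣_-_∣ (reflected-label m s ps) (reflected-label m t pt))
          (reflect-distance _ _ _ (<⇒≤ (below-reflector m s ps)) (<⇒≤ (below-reflector m t pt)))

  gap-persists : ∀ {k m} s t → k ≤′ m → Present k s → Present k t → gap m s t ≡ gap k s t
  gap-persists s t ≤′-refl _ _ = refl
  gap-persists s t (≤′-step k≤m) ps pt =
    trans (gap-step _ s t (present-weaken s k≤m ps) (present-weaken t k≤m pt))
          (gap-persists s t k≤m ps pt)

  -- The end of the path after j steps: the old vertex labelled 0, or inj₂ (j-1).
  newest : ℕ → Slot
  newest zero = inj₁ 0
  newest (suc j) = inj₂ j

  newest-present : ∀ j → Present j (newest j)
  newest-present zero = z≤n
  newest-present (suc j) = n<1+n j

  newest-label : ∀ j → stageLabel j (newest j) ≡ 0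
  newest-label zero = refl
  newest-label (suc j) = newborn-label j

  path-gap : ∀ {j m} → j < m → gap m (newest j) (newest (suc j)) ≡ q + suc j
  path-gap {j} {m} j<m = begin
    gap m (newest j) (newest (suc j))
      ≡⟨ gap-persists (newest j) (newest (suc j)) (≤⇒≤′ j<m)
           (present-step j (newest j) (newest-present j)) (n<1+n j) ⟩
    ∣ stageLabel (suc j) (newest j) - stageLabel (suc j) (inj₂ j) ∣
      ≡⟨ cong₂ ∣_-_∣ (reflected-label j (newest j) (newest-present j)) (newborn-label j) ⟩
    ∣ q + suc j ∸ stageLabel j (newest j) - 0 ∣
      ≡⟨ ∣-∣-identityʳ _ ⟩
    q + suc j ∸ stageLabel j (newest j)
      ≡⟨ cong (q + suc j ∸_) (newest-label j) ⟩
    q + suc j ∎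
    where open ≡-Reasoning

module Extension {q : ℕ} {G : RawGraph (suc q) q} (g : Graceful G)
                 (v : Fin (suc q)) (v-zero : Graceful.label g v ≡ 0) (m : ℕ) where
  open Graceful g
  open Growth q

  G′ : RawGraph (suc q + m) (q + m)
  G′ = glueRaw G v m

  toSlot : Fin (suc q) ⊎ Fin m → Slot
  toSlot (inj₁ x) = inj₁ (label x)
  toSlot (inj₂ j) = inj₂ (toℕ j)

  slot : Fin (suc q + m) → Slot
  slot w = toSlot (splitAt (suc q) w)

  label′ : Fin (suc q + m) → ℕ
  label′ w = stageLabel m (slot w)

  slot-old : ∀ x → slot (x ↑ˡ m) ≡ inj₁ (label x)
  slot-old x = cong toSlot (splitAt-↑ˡ (suc q) x m)

  slot-new : ∀ j → slot (suc q ↑ʳ j) ≡ inj₂ (toℕ j)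
  slot-new j = cong toSlot (splitAt-↑ʳ (suc q) m j)

  slot-present : ∀ w → Present m (slot w)
  slot-present w with splitAt (suc q) w
  ... | inj₁ x = label-bound x
  ... | inj₂ j = toℕ<n j

  toSlot-injective : ∀ {a b} → toSlot a ≡ toSlot b → a ≡ b
  toSlot-injective {inj₁ x} {inj₁ y} eq = cong inj₁ (label-injective (inj₁-injective eq))
  toSlot-injective {inj₂ i} {inj₂ j} eq = cong inj₂ (toℕ-injective (inj₂-injective eq))

  slot-surjective : ∀ s → Present m s → ∃ λ w → slot w ≡ s
  slot-surjective s p with preimage s p
    where
      preimage : ∀ s → Present m s → ∃ λ a → toSlot a ≡ s
      preimage (inj₁ a) a≤q with label-surjective a a≤q
      ... | x , xa = inj₁ x , cong inj₁ xa
      preimage (inj₂ j) j<m = inj₂ (fromℕ< j<m) , cong inj₂ (toℕ-fromℕ< j<m)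
  ... | a , eq = join (suc q) m a , trans (cong toSlot (splitAt-join (suc q) m a)) eq

  edgeTarget : Fin q ⊎ Fin m → ℕ
  edgeTarget (inj₁ e) = induced G label e
  edgeTarget (inj₂ j) = q + suc (toℕ j)

  edge-label′ : ∀ e → induced G′ label′ e ≡ edgeTarget (splitAt q e)
  edge-label′ e with splitAt q e
  ... | inj₁ e′ = trans (cong₂ (gap m) (slot-old (src G e′)) (slot-old (tgt G e′)))
                        (gap-persists {m = m} (inj₁ (label (src G e′))) (inj₁ (label (tgt G e′))) z≤′n (label-bound (src G e′)) (label-bound (tgt G e′)))
  ... | inj₂ zero = trans (cong₂ (gap m) (trans (slot-old v) (cong inj₁ v-zero)) (slot-new zero))
                          (path-gap (toℕ<n {m} zero))
  ... | inj₂ (suc j) = trans (cong₂ (gap m) (trans (slot-new (inject₁ j)) (cong inj₂ (toℕ-inject₁ j)))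
                                            (slot-new (suc j)))
                             (path-gap (toℕ<n (suc j)))

  old-below-path : ∀ e j → induced G label e < q + suc j
  old-below-path e j = ≤-<-trans (edge-bound e) (m<m+n q (s≤s z≤n))

  edgeTarget-injective : ∀ {a b} → edgeTarget a ≡ edgeTarget b → a ≡ b
  edgeTarget-injective {inj₁ e} {inj₁ e′} eq = cong inj₁ (edge-injective eq)
  edgeTarget-injective {inj₁ e} {inj₂ j} eq = ⊥-elim (<-irrefl eq (old-below-path e (toℕ j)))
  edgeTarget-injective {inj₂ j} {inj₁ e} eq = ⊥-elim (<-irrefl (sym eq) (old-below-path e (toℕ j)))
  edgeTarget-injective {inj₂ i} {inj₂ j} eq =
    cong inj₂ (toℕ-injective (suc-injective (+-cancelˡ-≡ q _ _ eq)))

  edgeTarget-positive : ∀ a → 1 ≤ edgeTarget a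
  edgeTarget-positive (inj₁ e) = edge-positive e
  edgeTarget-positive (inj₂ j) = ≤-trans (s≤s z≤n) (m≤n+m (suc (toℕ j)) q)

  edgeTarget-surjective : ∀ b → 1 ≤ b → b ≤ q + m → ∃ λ a → edgeTarget a ≡ b
  edgeTarget-surjective b 1≤b b≤top with b ≤? q
  ... | yes b≤q with edge-surjective b 1≤b b≤q
  ...   | e , eb = inj₁ e , eb
  edgeTarget-surjective b 1≤b b≤top | no b≰q = inj₂ (fromℕ< j<m) , trans (cong (λ i → q + suc i) (toℕ-fromℕ< j<m)) q+1+j≡b
    where
      j : ℕ
      j = b ∸ suc q
      q+1+j≡b : q + suc j ≡ b
      q+1+j≡b = trans (+-suc q j) (m+[n∸m]≡n (≰⇒> b≰q))
      j<m : j < m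
      j<m = +-cancelˡ-≤ q _ _ (subst (_≤ q + m) (sym q+1+j≡b) b≤top)

  graceful : Graceful G′
  graceful = record
    { label            = label′
    ; label-bound      = λ w → stage-bound m (slot w) (slot-present w)
    ; label-injective  = λ {w} {w′} eq → splitAt-injective (suc q) (toSlot-injective
        (stage-injective m (slot w) (slot w′) (slot-present w) (slot-present w′) eq))
    ; label-surjective = vertex-surjective
    ; edge-positive    = λ e → subst (1 ≤_) (sym (edge-label′ e)) (edgeTarget-positive (splitAt q e))
    ; edge-injective   = λ {e} {e′} eq → splitAt-injective q (edgeTarget-injective
        (trans (sym (edge-label′ e)) (trans eq (edge-label′ e′))))
    ; edge-surjective  = edge-surjective′
    }
    where
      vertex-surjective : ∀ a → a ≤ q + m → ∃ λ w → label′ w ≡ a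
      vertex-surjective a a≤top with stage-surjective m a a≤top
      ... | s , p , sa with slot-surjective s p
      ...   | w , ws = w , trans (cong (stageLabel m) ws) sa

      edge-surjective′ : ∀ b → 1 ≤ b → b ≤ q + m → ∃ λ e → induced G′ label′ e ≡ b
      edge-surjective′ b 1≤b b≤top with edgeTarget-surjective b 1≤b b≤top
      ... | a , ab = join q m a , trans (edge-label′ (join q m a))
                                        (trans (cong edgeTarget (splitAt-join q m a)) ab)

extend-along-path : ∀ {q} {G : RawGraph (suc q) q} (g : Graceful G) (v : Fin (suc q)) →
  Graceful.label g v ≡ 0 → (m : ℕ) →
  ∃ λ (g′ : Graceful (glueRaw G v (suc m))) → Graceful.label g′ (suc q ↑ʳ fromℕ m) ≡ 0
extend-along-path {q} g v v-zero m =
  Extension.graceful g v v-zero (suc m) ,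
  trans (cong (Growth.stageLabel q (suc m))
              (trans (Extension.slot-new g v v-zero (suc m) (fromℕ m)) (cong inj₂ (toℕ-fromℕ m))))
        (Growth.newborn-label q m)

theorem2p10 : (q : ℕ) → 1 ≤ q → (G : RawGraph (suc q) q) → IsGraph G →
    (L : SuperGraceful 1 G) → AllVerticesOdd L →
    (v : Fin (suc q)) → SuperGraceful.f L (inj₁ v) ≡ 1 →
    (n : ℕ) → (h : 2 ≤ n) →
    ∃ λ (L′ : SuperGraceful 1 (Gvn G v n)) →
      AllVerticesOdd L′ × SuperGraceful.f L′ (inj₁ (lastPathVertex n h)) ≡ 1
theorem2p10 q _ G _ L odd v fv (suc (suc m)) (s≤s (s≤s z≤n)) =
  Encode.superGraceful g′ , Encode.all-odd g′ , cong (λ a → suc (2 * a)) last-zero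
  where
    g : Graceful G
    g = Decode.graceful L odd

    v-zero : Graceful.label g v ≡ 0
    v-zero = *-cancelˡ-≡ _ 0 2 (suc-injective (trans (sym (Decode.vertex-label L odd v)) fv))

    g′ : Graceful (glueRaw G v (suc m))
    g′ = proj₁ (extend-along-path g v v-zero m)

    last-zero : Graceful.label g′ (suc q ↑ʳ fromℕ m) ≡ 0
    last-zero = proj₂ (extend-along-path g v v-zero m)
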